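{- (i) $\mathrm{DHL}[3,2]$ implies that $\mathcal{D}$ is the set of all positive even integers. (ii) $\mathrm{DHL}[4,2]$ implies that $\mathcal{D}$ contains every positive multiple of $4$. (iii) $\mathrm{DHL}[5,2]$ implies that $\min\mathcal{D}\le 6$. (iv) $\mathrm{DHL}[6,2]$ implies that $8\in\mathcal{D}$.
   Context: $\phi$ denotes Euler's totient function. $\mathcal{D}$ denotes the set of positive integers $d$ for which the equation $\phi(a)-\phi(b)=d$ has infinitely many solution pairs $(a,b)$ of positive integers. A finite set of affine-linear forms $a_1x+b_1,\ldots,a_kx+b_k$ with positive integers $a_i$ and integers $b_i$ is called admissible if for every prime $p$ there is an integer $x$ with $p\nmid (a_1x+b_1)\cdots(a_kx+b_k)$. For positive integers $k,m$, the hypothesis $\mathrm{DHL}[k,m]$ is the statement: for any admissible $k$-tuple of linear forms $a_in+b_i$ ($1\le i\le k$), there are infinitely many positive integers $n$ for which at least $m$ of the numbers $a_in+b_i$ are simultaneously prime. -}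

module Defs where

open import Data.Nat as ℕ using (ℕ; zero; suc; _<_; _≤_)
open import Data.Nat.Coprimality using (coprime?)
open import Data.Nat.Primality using (Prime)
open import Data.Nat.Divisibility as ND using ()
open import Data.Integer as ℤ using (ℤ; +_)
open import Data.Fin using (Fin) renaming (zero to fzero; suc to fsuc)
open import Data.List using (List; length; filter; map; upTo)
open import Data.Product using (Σ; ∃; ∃-syntax; _×_)
open import Data.Sum using (_⊎_)
open import Relation.Nullary using (¬_)
open import Relation.Binary.PropositionalEquality using (_≡_)
open import Function.Definitions using (Injective)

φ : ℕ → ℕ
φ n = length (filter (λ i → coprime? i n) (map suc (upTo n)))

InfinitelyManySolutions : ℕ → Set
InfinitelyManySolutions d =
  ∀ (N : ℕ) → ∃[ a ] ∃[ b ] (0 < a × 0 < b × N < a ℕ.+ b × φ a ≡ φ b ℕ.+ d)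

InD : ℕ → Set
InD d = 0 < d × InfinitelyManySolutions d

form : ℕ → ℤ → ℤ → ℤ
form a b x = (+ a) ℤ.* x ℤ.+ b

prodFin : (k : ℕ) → (Fin k → ℤ) → ℤ
prodFin zero f = + 1
prodFin (suc k) f = f fzero ℤ.* prodFin k (λ i → f (fsuc i))

Admissible : (k : ℕ) → (Fin k → ℕ) → (Fin k → ℤ) → Set
Admissible k A B =
  ∀ (p : ℕ) → Prime p → ∃[ x ] ¬ (p ND.∣ ℤ.∣ prodFin k (λ i → form (A i) (B i) x) ∣)

IsPrimeℤ : ℤ → Set
IsPrimeℤ z = ∃[ p ] (z ≡ + p × Prime p)

DHL : ℕ → ℕ → Set
DHL k m =
  (A : Fin k → ℕ) (B : Fin k → ℤ) → (∀ i → 0 < A i) → Admissible k A B →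
  ∀ (N : ℕ) → ∃[ n ] (N < n ×
    Σ (Fin m → Fin k) λ σ → Injective _≡_ _≡_ σ × (∀ j → IsPrimeℤ (form (A (σ j)) (B (σ j)) (+ n))))

-- If P and Q are primes with P ∤ c and Q ∤ c′, then φ(P c) − φ(Q c′) = (P − 1) φ(c) − (Q − 1) φ(c′).
-- When P = m n + β and Q = m′ n + β′ come from two linear forms evaluated at the same n, this
-- difference does not depend on n as soon as φ(c) m = φ(c′) m′, and it equals d when moreover
-- φ(c)(β − 1) = φ(c′)(β′ − 1) + d.  So one exhibits k admissible linear forms together with such
-- cofactors for every pair of them; DHL[k,2] makes two of the forms prime for infinitely many n,
-- and each such n yields a solution of φ(a) − φ(b) = d.  To reach all even d (or all multiples
-- of 4) at once, the offsets depend affinely on a parameter t; admissibility at the primes 2 and 3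
-- then only depends on t modulo 6, and larger primes are handled by pigeonhole.  Conversely, φ(n)
-- is even for n ≥ 3 and n ≤ 2 φ(n)², so for odd d every solution has a or b at most 2 and is bounded.
module Submission where

open import Data.Empty using (⊥-elim)
open import Data.Fin as Fin using (Fin) renaming (zero to fzero; suc to fsuc)
import Data.Fin.Properties as Fin
open import Data.Integer as ℤ using (ℤ; +_; _◃_)
open import Data.Integer.Divisibility.Signed as Signed using (∣ᵤ⇒∣; ∣⇒∣ᵤ) renaming (_∣_ to _∣ℤ_)
import Data.Integer.Properties as ℤ
import Data.Integer.Tactic.RingSolver as ℤ-Solver
open import Data.List using ([]; _∷_; length; filter; applyUpTo)
open import Data.List.Properties using (map-upTo)
open import Data.List.Relation.Unary.All using (_∷_)
open import Data.Nat
open import Data.Nat.Coprimality as Coprime using (Coprime; coprime?; coprime-divisor)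
open import Data.Nat.Divisibility
open import Data.Nat.DivMod using (_%_; _/_; m%n<n; m≡m%n+[m/n]*n)
open import Data.Nat.Induction using (<-rec)
open import Data.Nat.ListAction using (product)
open import Data.Nat.Primality
open import Data.Nat.Primality.Factorisation using (factorise)
open import Data.Nat.Properties
open import Data.Nat.Tactic.RingSolver using (solve-∀)
open import Data.Product using (_×_; _,_; proj₁; proj₂; ∃-syntax)
open import Data.Sign as Sign using (Sign)
open import Data.Sum using (_⊎_; inj₁; inj₂)
open import Data.Vec using (Vec; []; _∷_; lookup)
open import Function using (_∘_; _⇔_; mk⇔; Equivalence; case_of_)
open import Relation.Binary.PropositionalEquality
open import Relation.Nullary using (¬_; ¬?; Dec; yes; no; contradiction; _×-dec_; _⊎-dec_; _→-dec_)
open import Relation.Nullary.Decidable using (from-yes)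
open import Relation.Unary using (Decidable)

open import Defs

-- Euler's totient function as a sum

indicator : {P : Set} → Dec P → ℕ
indicator (yes _) = 1
indicator (no _) = 0

indicator-cong : {P Q : Set} → P ⇔ Q → (p? : Dec P) (q? : Dec Q) → indicator p? ≡ indicator q?
indicator-cong P⇔Q (yes p) (yes q) = refl
indicator-cong P⇔Q (yes p) (no ¬q) = contradiction (Equivalence.to P⇔Q p) ¬q
indicator-cong P⇔Q (no ¬p) (yes q) = contradiction (Equivalence.from P⇔Q q) ¬p
indicator-cong P⇔Q (no ¬p) (no ¬q) = refl

sum< : ℕ → (ℕ → ℕ) → ℕ
sum< zero    f = 0
sum< (suc n) f = f 0 + sum< n (f ∘ suc)

sum<-cong : ∀ n {f g} → (∀ i → i < n → f i ≡ g i) → sum< n f ≡ sum< n g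
sum<-cong zero    f≗g = refl
sum<-cong (suc n) f≗g = cong₂ _+_ (f≗g 0 z<s) (sum<-cong n (λ i i<n → f≗g (suc i) (s<s i<n)))

sum<-+ : ∀ m n f → sum< (m + n) f ≡ sum< m f + sum< n (λ i → f (m + i))
sum<-+ zero    n f = refl
sum<-+ (suc m) n f = trans (cong (λ s → f 0 + s) (sum<-+ m n (f ∘ suc))) (sym (+-assoc (f 0) _ _))

sum<-suc : ∀ n f → sum< (suc n) f ≡ sum< n f + f n
sum<-suc n f = begin
  sum< (suc n) f              ≡⟨ cong (λ m → sum< m f) (+-comm 1 n) ⟩
  sum< (n + 1) f              ≡⟨ sum<-+ n 1 f ⟩
  sum< n f + (f (n + 0) + 0)  ≡⟨ cong (λ s → sum< n f + s) (trans (+-identityʳ _) (cong f (+-identityʳ n))) ⟩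
  sum< n f + f n              ∎
  where open ≡-Reasoning

sum<-distrib : ∀ n f g → sum< n (λ i → f i + g i) ≡ sum< n f + sum< n g
sum<-distrib zero    f g = refl
sum<-distrib (suc n) f g = begin
  f 0 + g 0 + sum< n (λ i → f (suc i) + g (suc i))
    ≡⟨ cong (λ s → f 0 + g 0 + s) (sum<-distrib n (f ∘ suc) (g ∘ suc)) ⟩
  f 0 + g 0 + (sum< n (f ∘ suc) + sum< n (g ∘ suc))
    ≡⟨ shuffle (f 0) (g 0) _ _ ⟩
  f 0 + sum< n (f ∘ suc) + (g 0 + sum< n (g ∘ suc)) ∎
  where
  open ≡-Reasoning
  shuffle : ∀ a b c d → a + b + (c + d) ≡ a + c + (b + d)
  shuffle = solve-∀

sum<-const : ∀ n c → sum< n (λ _ → c) ≡ n * c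
sum<-const zero    c = refl
sum<-const (suc n) c = cong (λ s → c + s) (sum<-const n c)

sum<-zero : ∀ n {f} → (∀ i → i < n → f i ≡ 0) → sum< n f ≡ 0
sum<-zero n f≗0 = trans (sum<-cong n f≗0) (trans (sum<-const n 0) (*-zeroʳ n))

sum<-blocks : ∀ m n f → sum< (m * n) f ≡ sum< m (λ j → sum< n (λ r → f (j * n + r)))
sum<-blocks zero    n f = refl
sum<-blocks (suc m) n f = begin
  sum< (n + m * n) f
    ≡⟨ sum<-+ n (m * n) f ⟩
  sum< n f + sum< (m * n) (λ i → f (n + i))
    ≡⟨ cong (λ s → sum< n f + s) (sum<-blocks m n (λ i → f (n + i))) ⟩
  sum< n f + sum< m (λ j → sum< n (λ r → f (n + (j * n + r))))
    ≡⟨ cong (λ s → sum< n f + s) (sum<-cong m (λ j _ → sum<-cong n (λ r _ → cong f (sym (+-assoc n (j * n) r))))) ⟩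
  sum< n f + sum< m (λ j → sum< n (λ r → f (n + j * n + r))) ∎
  where open ≡-Reasoning

sum<-multiples : ∀ q c (g : ℕ → ℕ) →
  sum< (c * suc q) (λ i → indicator (suc q ∣? suc i) * g (suc i)) ≡ sum< c (λ j → g (suc j * suc q))
sum<-multiples q c g = begin
  sum< (c * suc q) term                                    ≡⟨ sum<-blocks c (suc q) term ⟩
  sum< c (λ j → sum< (suc q) (λ r → term (j * suc q + r))) ≡⟨ sum<-cong c (λ j _ → block j) ⟩
  sum< c (λ j → g (suc j * suc q))                         ∎
  where
  open ≡-Reasoning
  term : ℕ → ℕ
  term i = indicator (suc q ∣? suc i) * g (suc i)
  last : ∀ j q → suc (j * suc q + q) ≡ suc j * suc q
  last = solve-∀
  interior : ∀ j r → r < q → term (j * suc q + r) ≡ 0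
  interior j r r<q with suc q ∣? suc (j * suc q + r)
  ... | no  _ = refl
  ... | yes p∣ = contradiction (∣⇒≤ (∣m+n∣m⇒∣n (subst (suc q ∣_) (sym (+-suc (j * suc q) r)) p∣) (n∣m*n j)))
                               (<⇒≱ (s<s r<q))
  endpoint : ∀ j → term (j * suc q + q) ≡ g (suc j * suc q)
  endpoint j with suc q ∣? suc (j * suc q + q)
  ... | yes _ = trans (+-identityʳ _) (cong g (last j q))
  ... | no p∤ = contradiction (subst (suc q ∣_) (sym (last j q)) (n∣m*n (suc j))) p∤
  block : ∀ j → sum< (suc q) (λ r → term (j * suc q + r)) ≡ g (suc j * suc q)
  block j = begin
    sum< (suc q) (λ r → term (j * suc q + r))                    ≡⟨ sum<-suc q _ ⟩
    sum< q (λ r → term (j * suc q + r)) + term (j * suc q + q)   ≡⟨ cong₂ _+_ (sum<-zero q (interior j)) (endpoint j) ⟩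
    g (suc j * suc q)                                            ∎

length-filter-applyUpTo : {P : ℕ → Set} (P? : Decidable P) (f : ℕ → ℕ) (n : ℕ) →
  length (filter P? (applyUpTo f n)) ≡ sum< n (λ i → indicator (P? (f i)))
length-filter-applyUpTo P? f zero = refl
length-filter-applyUpTo P? f (suc n) with P? (f 0)
... | yes _ = cong suc (length-filter-applyUpTo P? (f ∘ suc) n)
... | no  _ = length-filter-applyUpTo P? (f ∘ suc) n

coprimeTo : ℕ → ℕ → ℕ
coprimeTo n i = indicator (coprime? (suc i) n)

φ-as-sum : ∀ n → φ n ≡ sum< n (coprimeTo n)
φ-as-sum n = trans (cong (length ∘ filter (λ i → coprime? i n)) (map-upTo suc n))
                   (length-filter-applyUpTo (λ i → coprime? i n) suc n)

coprime-+-multiple : ∀ j {a c} → Coprime (j * c + a) c ⇔ Coprime a c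
coprime-+-multiple j = mk⇔
  (λ cop {_} (d∣a , d∣c) → cop (∣m∣n⇒∣m+n (∣n⇒∣m*n j d∣c) d∣a , d∣c))
  (λ cop {_} (d∣x , d∣c) → cop (∣m+n∣m⇒∣n d∣x (∣n⇒∣m*n j d∣c) , d∣c))

prime⇒coprime-unless-∣ : ∀ {p a} → Prime p → ¬ p ∣ a → Coprime a p
prime⇒coprime-unless-∣ pp p∤a {d} (d∣a , d∣p) with prime⇒irreducible pp d∣p
... | inj₁ d≡1 = d≡1
... | inj₂ refl = contradiction d∣a p∤a

coprime-*ʳ⇒coprime : ∀ {a} p {c} → Coprime a (p * c) → Coprime a c
coprime-*ʳ⇒coprime p cop (d∣a , d∣c) = cop (d∣a , ∣n⇒∣m*n p d∣c)

coprime-*-prime⇒∤ : ∀ {p a c} → Prime p → Coprime a (p * c) → ¬ p ∣ a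
coprime-*-prime⇒∤ {c = c} pp cop p∣a = ¬prime[1] (subst Prime (cop (p∣a , m∣m*n c)) pp)

coprime∧∤⇒coprime-*-prime : ∀ {p a c} → Prime p → Coprime a c → ¬ p ∣ a → Coprime a (p * c)
coprime∧∤⇒coprime-*-prime pp cop p∤a (d∣a , d∣pc) =
  cop (d∣a , coprime-divisor (λ (e∣d , e∣p) → prime⇒coprime-unless-∣ pp p∤a (∣-trans e∣d d∣a , e∣p)) d∣pc)

coprime-*-prime-∤ : ∀ {p b c} → Prime p → ¬ p ∣ c → Coprime (p * b) c ⇔ Coprime b c
coprime-*-prime-∤ {p} {b} {c} pp p∤c = mk⇔ {A = Coprime (p * b) c} {B = Coprime b c}
  (λ cop → Coprime.sym (coprime-*ʳ⇒coprime p (Coprime.sym cop)))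
  (λ cop → Coprime.sym (coprime∧∤⇒coprime-*-prime pp (Coprime.sym cop) p∤c))

coprime-to-product-split : ∀ {p c} → Prime p → ∀ a →
  indicator (coprime? a (p * c)) + indicator (p ∣? a) * indicator (coprime? a c) ≡ indicator (coprime? a c)
coprime-to-product-split {p} {c} pp a with coprime? a (p * c) | p ∣? a | coprime? a c
... | yes cop | yes p∣a | _       = contradiction p∣a (coprime-*-prime⇒∤ pp cop)
... | yes cop | no  _   | yes _   = refl
... | yes cop | no  _   | no ¬cop = ⊥-elim (¬cop (coprime-*ʳ⇒coprime p cop))
... | no  _   | yes _   | yes _   = refl
... | no  _   | yes _   | no  _   = refl
... | no ¬cop | no p∤a  | yes cop = ⊥-elim (¬cop (coprime∧∤⇒coprime-*-prime pp cop p∤a))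
... | no  _   | no  _   | no  _   = refl

φ-periodic : ∀ m c → sum< (m * c) (coprimeTo c) ≡ m * φ c
φ-periodic m c = begin
  sum< (m * c) (coprimeTo c)                              ≡⟨ sum<-blocks m c (coprimeTo c) ⟩
  sum< m (λ j → sum< c (λ r → coprimeTo c (j * c + r)))  ≡⟨ sum<-cong m (λ j _ → sum<-cong c (λ r _ → shift j r)) ⟩
  sum< m (λ _ → sum< c (coprimeTo c))                     ≡⟨ sum<-const m _ ⟩
  m * sum< c (coprimeTo c)                                ≡⟨ cong (m *_) (sym (φ-as-sum c)) ⟩
  m * φ c                                                 ∎
  where
  open ≡-Reasoning
  shift : ∀ j r → coprimeTo c (j * c + r) ≡ coprimeTo c r
  shift j r = trans (cong (λ x → indicator (coprime? x c)) (sym (+-suc (j * c) r)))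
                    (indicator-cong (coprime-+-multiple j) _ _)

φ-*-∣ : ∀ {p c} → Prime p → p ∣ c → φ (p * c) ≡ p * φ c
φ-*-∣ {p} {c} pp p∣c = begin
  φ (p * c)                      ≡⟨ φ-as-sum (p * c) ⟩
  sum< (p * c) (coprimeTo (p * c)) ≡⟨ sum<-cong (p * c) (λ i _ → indicator-cong coprime-iff _ _) ⟩
  sum< (p * c) (coprimeTo c)       ≡⟨ φ-periodic p c ⟩
  p * φ c                        ∎
  where
  open ≡-Reasoning
  coprime-iff : ∀ {a} → Coprime a (p * c) ⇔ Coprime a c
  coprime-iff {a} = mk⇔ {A = Coprime a (p * c)} (coprime-*ʳ⇒coprime p)
    (λ cop → coprime∧∤⇒coprime-*-prime pp cop (λ p∣a → ¬prime[1] (subst Prime (cop (p∣a , p∣c)) pp)))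

-- Among the i ≤ p c coprime to c, those sharing a factor with p c are the p j with j ≤ c coprime to c.
φ-*-∤ : ∀ {p c} → Prime p → ¬ p ∣ c → φ (p * c) ≡ (p ∸ 1) * φ c
φ-*-∤ {zero}          pp = contradiction pp ¬prime[0]
φ-*-∤ {p@(suc q)} {c} pp p∤c = +-cancelʳ-≡ (φ c) _ _ (begin
  φ (p * c) + φ c
    ≡⟨ cong₂ _+_ (φ-as-sum (p * c)) (trans (φ-as-sum c) (sym multiples)) ⟩
  sum< (p * c) (coprimeTo (p * c)) + sum< (p * c) (λ i → indicator (p ∣? suc i) * coprimeTo c i)
    ≡⟨ sym (sum<-distrib (p * c) _ _) ⟩
  sum< (p * c) (λ i → coprimeTo (p * c) i + indicator (p ∣? suc i) * coprimeTo c i)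
    ≡⟨ sum<-cong (p * c) (λ i _ → coprime-to-product-split pp (suc i)) ⟩
  sum< (p * c) (coprimeTo c)
    ≡⟨ φ-periodic p c ⟩
  φ c + q * φ c
    ≡⟨ +-comm (φ c) (q * φ c) ⟩
  q * φ c + φ c ∎)
  where
  open ≡-Reasoning
  multiples : sum< (p * c) (λ i → indicator (p ∣? suc i) * coprimeTo c i) ≡ sum< c (coprimeTo c)
  multiples = begin
    sum< (p * c) (λ i → indicator (p ∣? suc i) * coprimeTo c i)
      ≡⟨ cong (λ n → sum< n (λ i → indicator (p ∣? suc i) * coprimeTo c i)) (*-comm p c) ⟩
    sum< (c * p) (λ i → indicator (p ∣? suc i) * coprimeTo c i)
      ≡⟨ sum<-multiples q c (λ a → indicator (coprime? a c)) ⟩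
    sum< c (λ j → indicator (coprime? (suc j * p) c))
      ≡⟨ sum<-cong c (λ j _ → trans (cong (λ x → indicator (coprime? x c)) (*-comm (suc j) p))
                                    (indicator-cong (coprime-*-prime-∤ pp p∤c) _ _)) ⟩
    sum< c (coprimeTo c) ∎

pred-*-φ≤φ-* : ∀ {p} c → Prime p → (p ∸ 1) * φ c ≤ φ (p * c)
pred-*-φ≤φ-* {p} c pp with p ∣? c
... | yes p∣c = subst ((p ∸ 1) * φ c ≤_) (sym (φ-*-∣ pp p∣c)) (*-monoˡ-≤ (φ c) (m∸n≤m p 1))
... | no  p∤c = ≤-reflexive (sym (φ-*-∤ pp p∤c))

φ-pos : ∀ n → 0 < n → 0 < φ n
φ-pos (suc n) _ rewrite φ-as-sum (suc n) with coprime? 1 (suc n)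
... | yes _ = z<s
... | no ¬cop = ⊥-elim (¬cop (λ (d∣1 , _) → ∣1⇒≡1 d∣1))

-- Parity and growth of φ

2∣⊎2∣suc : ∀ n → 2 ∣ n ⊎ 2 ∣ suc n
2∣⊎2∣suc zero    = inj₁ (divides 0 refl)
2∣⊎2∣suc (suc n) with 2∣⊎2∣suc n
... | inj₁ 2∣n = inj₂ (∣m∣n⇒∣m+n (divides 1 refl) 2∣n)
... | inj₂ 2∣1+n = inj₁ 2∣1+n

prime⇒>1 : ∀ {p} → Prime p → 1 < p
prime⇒>1 {p} pp = nonTrivial⇒n>1 p {{prime⇒nonTrivial pp}}

prime⇒≡2⊎2∣pred : ∀ {p} → Prime p → p ≡ 2 ⊎ 2 ∣ p ∸ 1
prime⇒≡2⊎2∣pred {suc q} pp with 2∣⊎2∣suc q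
... | inj₁ 2∣q = inj₂ 2∣q
... | inj₂ 2∣p with prime⇒irreducible pp 2∣p
...   | inj₁ ()
...   | inj₂ 2≡p = inj₁ (sym 2≡p)

∃-prime-factor : ∀ n → 1 < n → ∃[ p ] ∃[ c ] (Prime p × n ≡ p * c)
∃-prime-factor n@(suc _) 1<n with factorise n
... | record { factors = [] ; isFactorisation = n≡1 } = contradiction n≡1 (>⇒≢ 1<n)
... | record { factors = p ∷ ps ; isFactorisation = n≡Π ; factorsPrime = pp ∷ _ } = p , product ps , pp , n≡Π

n≡p*c⇒0<c : ∀ {n} p {c} → 0 < n → n ≡ p * c → 0 < c
n≡p*c⇒0<c p {zero}  0<n n≡pc = contradiction (trans n≡pc (*-zeroʳ p)) (>⇒≢ 0<n)
n≡p*c⇒0<c p {suc _} 0<n n≡pc = z<s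

n≡p*c⇒c<n : ∀ {n p c} → Prime p → 0 < n → n ≡ p * c → c < n
n≡p*c⇒c<n {n} {p} {c} pp 0<n n≡pc =
  subst (c <_) (trans (*-comm c p) (sym n≡pc)) (m<m*n c p {{>-nonZero (n≡p*c⇒0<c p 0<n n≡pc)}} (prime⇒>1 pp))

odd>1⇒>2 : ∀ {c} → ¬ 2 ∣ c → 1 < c → 2 < c
odd>1⇒>2 {suc zero}          _   (s<s ())
odd>1⇒>2 {suc (suc zero)}    2∤c _ = contradiction ∣-refl 2∤c
odd>1⇒>2 {suc (suc (suc _))} _   _ = s<s (s<s z<s)

φ-even : ∀ n → 2 < n → 2 ∣ φ n
φ-even = <-rec _ step
  where
  step : ∀ n → (∀ {m} → m < n → 2 < m → 2 ∣ φ m) → 2 < n → 2 ∣ φ n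
  step n ih 2<n with ∃-prime-factor n (<-trans (s<s z<s) 2<n)
  ... | p , c , pp , n≡pc = subst (λ m → 2 ∣ φ m) (sym n≡pc) (split (p ∣? c) (prime⇒≡2⊎2∣pred pp))
    where
    0<n : 0 < n
    0<n = <-trans z<s 2<n
    IH : 2 < c → 2 ∣ φ c
    IH = ih (n≡p*c⇒c<n pp 0<n n≡pc)
    split : Dec (p ∣ c) → p ≡ 2 ⊎ 2 ∣ p ∸ 1 → 2 ∣ φ (p * c)
    split (yes p∣c) _ with 2 <? c
    ... | yes 2<c = subst (2 ∣_) (sym (φ-*-∣ pp p∣c)) (∣n⇒∣m*n p (IH 2<c))
    ... | no  2≮c = subst (2 ∣_) (sym (φ-*-∣ pp p∣c)) (∣m⇒∣m*n (φ c) (subst (2 ∣_) (sym p≡2) ∣-refl))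
      where
      p≡2 : p ≡ 2
      p≡2 = ≤-antisym (≤-trans (∣⇒≤ {{>-nonZero (n≡p*c⇒0<c p 0<n n≡pc)}} p∣c) (≮⇒≥ 2≮c)) (prime⇒>1 pp)
    split (no p∤c) (inj₁ refl) = subst (2 ∣_) (sym (trans (φ-*-∤ pp p∤c) (+-identityʳ (φ c))))
                                   (IH (odd>1⇒>2 p∤c (*-cancelˡ-< 2 1 c (subst (2 <_) n≡pc 2<n))))
    split (no p∤c) (inj₂ 2∣p-1) = subst (2 ∣_) (sym (φ-*-∤ pp p∤c)) (∣m⇒∣m*n (φ c) 2∣p-1)

n≤pred[n]² : ∀ {n} → 2 < n → n ≤ (n ∸ 1) * (n ∸ 1)
n≤pred[n]² {suc zero}          (s<s ())
n≤pred[n]² {suc (suc zero)}    (s<s (s<s ()))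
n≤pred[n]² {suc (suc (suc m))} _ = subst (3 + m ≤_) (expand m) (m≤m+n (3 + m) (m * m + 3 * m + 1))
  where
  expand : ∀ m → 3 + m + (m * m + 3 * m + 1) ≡ (2 + m) * (2 + m)
  expand = solve-∀

φ-odd-lower-bound : ∀ n → ¬ 2 ∣ n → 0 < n → n ≤ φ n * φ n
φ-odd-lower-bound = <-rec _ step
  where
  step : ∀ n → (∀ {m} → m < n → ¬ 2 ∣ m → 0 < m → m ≤ φ m * φ m) → ¬ 2 ∣ n → 0 < n → n ≤ φ n * φ n
  step (suc zero)      ih 2∤n 0<n = s≤s z≤n
  step n@(suc (suc _)) ih 2∤n 0<n with ∃-prime-factor n (s<s z<s)
  ... | p , c , pp , n≡pc = begin
    n                                          ≡⟨ n≡pc ⟩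
    p * c                                      ≤⟨ *-mono-≤ (n≤pred[n]² 2<p) (ih c<n 2∤c (n≡p*c⇒0<c p 0<n n≡pc)) ⟩
    ((p ∸ 1) * (p ∸ 1)) * (φ c * φ c)          ≡⟨ *-square (p ∸ 1) (φ c) ⟩
    ((p ∸ 1) * φ c) * ((p ∸ 1) * φ c)          ≤⟨ *-mono-≤ (pred-*-φ≤φ-* c pp) (pred-*-φ≤φ-* c pp) ⟩
    φ (p * c) * φ (p * c)                      ≡⟨ cong (λ m → φ m * φ m) (sym n≡pc) ⟩
    φ n * φ n                                  ∎
    where
    open ≤-Reasoning
    *-square : ∀ a b → (a * a) * (b * b) ≡ (a * b) * (a * b)
    *-square = solve-∀
    c<n : c < n
    c<n = n≡p*c⇒c<n pp 0<n n≡pc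
    2∤c : ¬ 2 ∣ c
    2∤c 2∣c = 2∤n (subst (2 ∣_) (sym n≡pc) (∣n⇒∣m*n p 2∣c))
    2<p : 2 < p
    2<p with prime⇒>1 pp | p ≟ 2
    ... | 1<p | no  p≢2 = ≤∧≢⇒< 1<p (p≢2 ∘ sym)
    ... | _   | yes refl = contradiction (subst (2 ∣_) (sym n≡pc) (m∣m*n c)) 2∤n

φ-lower-bound : ∀ n → 0 < n → n ≤ 2 * (φ n * φ n)
φ-lower-bound = <-rec _ step
  where
  step : ∀ n → (∀ {m} → m < n → 0 < m → m ≤ 2 * (φ m * φ m)) → 0 < n → n ≤ 2 * (φ n * φ n)
  step n ih 0<n with 2 ∣? n
  ... | no 2∤n = ≤-trans (φ-odd-lower-bound n 2∤n 0<n) (m≤m+n _ _)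
  ... | yes (divides c n≡c*2) = subst (λ m → m ≤ 2 * (φ m * φ m)) (sym n≡2c) (double (2 ∣? c))
    where
    open ≤-Reasoning
    n≡2c : n ≡ 2 * c
    n≡2c = trans n≡c*2 (*-comm c 2)
    0<c : 0 < c
    0<c = n≡p*c⇒0<c 2 0<n n≡2c
    double-square : ∀ x → 2 * (x * x) + 2 * (x * x) ≡ (2 * x) * (2 * x)
    double-square = solve-∀
    double : Dec (2 ∣ c) → 2 * c ≤ 2 * (φ (2 * c) * φ (2 * c))
    double (yes 2∣c) = begin
      2 * c                                          ≤⟨ *-monoʳ-≤ 2 (ih {c} (n≡p*c⇒c<n prime[2] 0<n n≡2c) 0<c) ⟩
      2 * (2 * (φ c * φ c))                          ≤⟨ *-monoʳ-≤ 2 (m≤m+n (2 * (φ c * φ c)) (2 * (φ c * φ c))) ⟩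
      2 * (2 * (φ c * φ c) + 2 * (φ c * φ c))        ≡⟨ cong (2 *_) (double-square (φ c)) ⟩
      2 * ((2 * φ c) * (2 * φ c))                    ≡⟨ cong (λ m → 2 * (m * m)) (sym (φ-*-∣ prime[2] 2∣c)) ⟩
      2 * (φ (2 * c) * φ (2 * c))                    ∎
    double (no 2∤c) = begin
      2 * c                           ≤⟨ *-monoʳ-≤ 2 (φ-odd-lower-bound c 2∤c 0<c) ⟩
      2 * (φ c * φ c)                 ≡⟨ cong (λ m → 2 * (m * m)) (sym (trans (φ-*-∤ prime[2] 2∤c) (+-identityʳ _))) ⟩
      2 * (φ (2 * c) * φ (2 * c))     ∎

n≤2⇒φ≡1 : ∀ {a} → 0 < a → a ≤ 2 → φ a ≡ 1
n≤2⇒φ≡1 {1} _ _ = refl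
n≤2⇒φ≡1 {2} _ _ = refl
n≤2⇒φ≡1 {suc (suc (suc _))} _ (s≤s (s≤s ()))

odd-difference⇒bounded : ∀ {a b d} → ¬ 2 ∣ d → 0 < a → 0 < b → φ a ≡ φ b + d →
  a + b ≤ 2 * (suc d * suc d) + 2
odd-difference⇒bounded {a} {b} {d} 2∤d 0<a 0<b φa≡φb+d with a ≤? 2 | b ≤? 2
... | yes a≤2 | _ = contradiction (n≤0⇒n≡0 (+-cancelˡ-≤ 1 d 0 1+d≤1)) (λ { refl → 2∤d (divides 0 refl) })
  where
  open ≤-Reasoning
  1+d≤1 : 1 + d ≤ 1 + 0
  1+d≤1 = begin
    1 + d    ≤⟨ +-monoˡ-≤ d (φ-pos b 0<b) ⟩
    φ b + d  ≡⟨ sym φa≡φb+d ⟩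
    φ a      ≡⟨ n≤2⇒φ≡1 0<a a≤2 ⟩
    1        ∎
... | no a≰2 | yes b≤2 = +-mono-≤ a≤ b≤2
  where
  φa≡1+d : φ a ≡ suc d
  φa≡1+d = trans φa≡φb+d (cong (_+ d) (n≤2⇒φ≡1 0<b b≤2))
  a≤ : a ≤ 2 * (suc d * suc d)
  a≤ = subst (λ m → a ≤ 2 * (m * m)) φa≡1+d (φ-lower-bound a 0<a)
... | no a≰2 | no b≰2 =
  contradiction (∣m+n∣m⇒∣n (subst (2 ∣_) φa≡φb+d (φ-even a (≰⇒> a≰2))) (φ-even b (≰⇒> b≰2))) 2∤d

InfinitelyManySolutions⇒even : ∀ {d} → InfinitelyManySolutions d → 2 ∣ d
InfinitelyManySolutions⇒even {d} sols with 2 ∣? d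
... | yes 2∣d = 2∣d
... | no  2∤d with sols (2 * (suc d * suc d) + 2)
...   | a , b , 0<a , 0<b , N<a+b , φa≡φb+d = contradiction (odd-difference⇒bounded 2∤d 0<a 0<b φa≡φb+d) (<⇒≱ N<a+b)

-- Linear forms and admissibility

Eventually : (ℕ → Set) → Set
Eventually P = ∃[ n₀ ] ∀ {n} → n₀ < n → P n

eventually-∀ : ∀ k {P : Fin k → ℕ → Set} → (∀ i → Eventually (P i)) → Eventually (λ n → ∀ i → P i n)
eventually-∀ zero    _  = 0 , λ _ ()
eventually-∀ (suc k) ev with ev fzero | eventually-∀ k (ev ∘ fsuc)
... | n₀ , P₀ | n₁ , P₁ = n₀ ⊔ n₁ , λ where
  n₀⊔n₁<n fzero    → P₀ (m⊔n<o⇒m<o n₀ n₁ n₀⊔n₁<n)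
  n₀⊔n₁<n (fsuc i) → P₁ (m⊔n<o⇒n<o n₀ n₁ n₀⊔n₁<n) i

form≡+⇒≤ : ∀ {m b n P} → 0 < m → form m b (+ n) ≡ + P → n ≤ P + ℤ.∣ b ∣
form≡+⇒≤ {m} {b} {n} {P} 0<m form≡P = begin
  n                               ≤⟨ m≤n*m n m {{>-nonZero 0<m}} ⟩
  m * n                           ≡⟨ cong ℤ.∣_∣ (ℤ.pos-* m n) ⟩
  ℤ.∣ + m ℤ.* + n ∣               ≡⟨ cong ℤ.∣_∣ (add-sub (+ m ℤ.* + n) b) ⟩
  ℤ.∣ form m b (+ n) ℤ.- b ∣      ≤⟨ ℤ.∣i-j∣≤∣i∣+∣j∣ (form m b (+ n)) b ⟩
  ℤ.∣ form m b (+ n) ∣ + ℤ.∣ b ∣  ≡⟨ cong (λ z → ℤ.∣ z ∣ + ℤ.∣ b ∣) form≡P ⟩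
  P + ℤ.∣ b ∣                     ∎
  where
  open ≤-Reasoning
  add-sub : ∀ x y → x ≡ x ℤ.+ y ℤ.- y
  add-sub = ℤ-Solver.solve-∀

AdmissibleAt : ℕ → (k : ℕ) → (Fin k → ℕ) → (Fin k → ℤ) → Set
AdmissibleAt p k A B = ∃[ x ] ¬ (p ∣ ℤ.∣ prodFin k (λ i → form (A i) (B i) x) ∣)

prime∤prodFin : ∀ {p} → Prime p → ∀ k (f : Fin k → ℤ) →
  (∀ i → ¬ p ∣ ℤ.∣ f i ∣) → ¬ p ∣ ℤ.∣ prodFin k f ∣
prime∤prodFin pp zero    f p∤f p∣1 = <⇒≱ (prime⇒>1 pp) (∣⇒≤ p∣1)
prime∤prodFin pp (suc k) f p∤f p∣Π rewrite ℤ.abs-* (f fzero) (prodFin k (f ∘ fsuc))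
  with euclidsLemma _ _ pp p∣Π
... | inj₁ p∣f₀ = p∤f fzero p∣f₀
... | inj₂ p∣Π′ = prime∤prodFin pp k (f ∘ fsuc) (p∤f ∘ fsuc) p∣Π′

form-shift : ∀ a b x δ → form a b (+ (x + δ)) ℤ.- form a b (+ x) ≡ + (a * δ)
form-shift a b x δ rewrite ℤ.pos-+ x δ | ℤ.pos-* a δ = shift (+ a) b (+ x) (+ δ)
  where
  shift : ∀ a b x δ → a ℤ.* (x ℤ.+ δ) ℤ.+ b ℤ.- (a ℤ.* x ℤ.+ b) ≡ a ℤ.* δ
  shift = ℤ-Solver.solve-∀

prime∣form-unique : ∀ {p a b x δ} → Prime p → ¬ p ∣ a → 0 < δ → δ < p →
  p ∣ ℤ.∣ form a b (+ x) ∣ → ¬ p ∣ ℤ.∣ form a b (+ (x + δ)) ∣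
prime∣form-unique {p} {a} {b} {x} {δ} pp p∤a 0<δ δ<p p∣f[x] p∣f[x+δ] =
  case euclidsLemma a δ pp p∣aδ of λ where
    (inj₁ p∣a) → p∤a p∣a
    (inj₂ p∣δ) → <⇒≱ δ<p (∣⇒≤ {{>-nonZero 0<δ}} p∣δ)
  where
  p∣aδ : p ∣ a * δ
  p∣aδ = ∣⇒∣ᵤ (subst (+ p ∣ℤ_) (form-shift a b x δ)
                     (Signed.∣m∣n⇒∣m-n (∣ᵤ⇒∣ {+ p} {form a b (+ (x + δ))} p∣f[x+δ])
                                       (∣ᵤ⇒∣ {+ p} {form a b (+ x)} p∣f[x])))

admissibleAt-large-prime : ∀ {p k} (A : Fin k → ℕ) (B : Fin k → ℤ) → Prime p → k < p → (∀ i → ¬ p ∣ A i) →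
  AdmissibleAt p k A B
admissibleAt-large-prime {p} {k} A B pp k<p p∤A =
  search (Fin.any? (λ x → Fin.all? (λ i → ¬? (p ∣? ℤ.∣ value i x ∣))))
  where
  value : Fin k → Fin (suc k) → ℤ
  value i x = form (A i) (B i) (+ Fin.toℕ x)
  root : ¬ (∃[ x ] ∀ i → ¬ p ∣ ℤ.∣ value i x ∣) → ∀ x → ∃[ i ] p ∣ ℤ.∣ value i x ∣
  root ¬good x with Fin.any? (λ i → p ∣? ℤ.∣ value i x ∣)
  ... | yes r = r
  ... | no ¬r = ⊥-elim (¬good (x , λ i p∣ → ¬r (i , p∣)))
  -- k + 1 sample points and k forms: some form would have two roots less than p apart.
  search : Dec (∃[ x ] ∀ i → ¬ p ∣ ℤ.∣ value i x ∣) → AdmissibleAt p k A B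
  search (yes (x , p∤values)) = + Fin.toℕ x , prime∤prodFin pp k _ p∤values
  search (no ¬good) with Fin.pigeonhole (n<1+n k) (proj₁ ∘ root ¬good)
  ... | x , y , x<y , same = ⊥-elim (prime∣form-unique pp (p∤A i) (m<n⇒0<n∸m x<y) δ<p (proj₂ (root ¬good x)) p∣f[y])
    where
    i = proj₁ (root ¬good x)
    δ<p : Fin.toℕ y ∸ Fin.toℕ x < p
    δ<p = ≤-<-trans (m∸n≤m (Fin.toℕ y) (Fin.toℕ x)) (≤-<-trans (≤-pred (Fin.toℕ<n y)) k<p)
    p∣f[y] : p ∣ ℤ.∣ form (A i) (B i) (+ (Fin.toℕ x + (Fin.toℕ y ∸ Fin.toℕ x))) ∣
    p∣f[y] rewrite m+[n∸m]≡n (<⇒≤ x<y) | same = proj₂ (root ¬good y)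

admissible-from-small-primes : ∀ {k} {A : Fin k → ℕ} {B : Fin k → ℤ} M → k ≤ M →
  (∀ i → 0 < A i) → (∀ i → A i ≤ M) → (∀ p → Prime p → p ≤ M → AdmissibleAt p k A B) → Admissible k A B
admissible-from-small-primes {A = A} {B} M k≤M 0<A A≤M small p pp with p ≤? M
... | yes p≤M = small p pp p≤M
... | no  p≰M = admissibleAt-large-prime A B pp (≤-<-trans k≤M M<p)
                  (λ i p∣A → <⇒≱ (≤-<-trans (A≤M i) M<p) (∣⇒≤ {{>-nonZero (0<A i)}} p∣A))
  where
  M<p : M < p
  M<p = ≰⇒> p≰M

admissible-from-2-and-3 : ∀ {k} {A : Fin k → ℕ} {B : Fin k → ℤ} → k ≤ 4 → (∀ i → 0 < A i) → (∀ i → A i ≤ 4) →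
  AdmissibleAt 2 k A B → AdmissibleAt 3 k A B → Admissible k A B
admissible-from-2-and-3 {k} {A} {B} k≤4 0<A A≤4 at2 at3 = admissible-from-small-primes 4 k≤4 0<A A≤4 small
  where
  small : ∀ p → Prime p → p ≤ 4 → AdmissibleAt p k A B
  small 0 pp _ = contradiction pp ¬prime[0]
  small 1 pp _ = contradiction pp ¬prime[1]
  small 2 _  _ = at2
  small 3 _  _ = at3
  small 4 pp _ = contradiction pp (composite⇒¬prime composite[4])
  small (suc (suc (suc (suc (suc _))))) _ (s≤s (s≤s (s≤s (s≤s ()))))

AdmissibleWithin : ℕ → (k : ℕ) → (Fin k → ℕ) → (Fin k → ℤ) → Set
AdmissibleWithin p k A B = ∃[ x ] ¬ (p ∣ ℤ.∣ prodFin k (λ i → form (A i) (B i) (+ Fin.toℕ {p} x)) ∣)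

admissibleWithin? : ∀ p k A B → Dec (AdmissibleWithin p k A B)
admissibleWithin? p k A B = Fin.any? λ x → ¬? (_ ∣? _)

within⇒at : ∀ {p k A B} → AdmissibleWithin p k A B → AdmissibleAt p k A B
within⇒at (x , p∤Π) = + Fin.toℕ x , p∤Π

SmallPrimesAdmissible : ℕ → (k : ℕ) → (Fin k → ℕ) → (Fin k → ℤ) → Set
SmallPrimesAdmissible M k A B = ∀ (p : Fin (suc M)) → Prime (Fin.toℕ p) → AdmissibleWithin (Fin.toℕ p) k A B

smallPrimesAdmissible? : ∀ M k A B → Dec (SmallPrimesAdmissible M k A B)
smallPrimesAdmissible? M k A B = Fin.all? λ p → prime? (Fin.toℕ p) →-dec admissibleWithin? (Fin.toℕ p) k A B

smallPrimesAdmissible⇒ : ∀ {M k A B} → SmallPrimesAdmissible M k A B → ∀ p → Prime p → p ≤ M → AdmissibleAt p k A B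
smallPrimesAdmissible⇒ {k = k} {A} {B} check p pp p≤M =
  subst (λ q → AdmissibleAt q k A B) (Fin.toℕ-fromℕ< (s≤s p≤M))
        (within⇒at {k = k} {A} {B} (check (Fin.fromℕ< (s≤s p≤M)) (subst Prime (sym (Fin.toℕ-fromℕ< (s≤s p≤M))) pp)))

prodFin-congruent : ∀ {d} k (f g : Fin k → ℤ) → (∀ i → d ∣ℤ f i ℤ.- g i) → d ∣ℤ prodFin k f ℤ.- prodFin k g
prodFin-congruent zero    f g _ = Signed.divides (+ 0) refl
prodFin-congruent {d} (suc k) f g d∣f-g =
  subst (d ∣ℤ_) (regroup (f fzero) (g fzero) (prodFin k (f ∘ fsuc)) (prodFin k (g ∘ fsuc)))
        (Signed.∣m∣n⇒∣m+n (Signed.∣m⇒∣m*n _ (d∣f-g fzero))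
                          (Signed.∣n⇒∣m*n (g fzero) (prodFin-congruent k (f ∘ fsuc) (g ∘ fsuc) (d∣f-g ∘ fsuc))))
  where
  regroup : ∀ a b x y → (a ℤ.- b) ℤ.* x ℤ.+ b ℤ.* (x ℤ.- y) ≡ a ℤ.* x ℤ.- b ℤ.* y
  regroup = ℤ-Solver.solve-∀

at-residue : ∀ (P : ℕ → Set) p .{{_ : NonZero p}} → (∀ (r : Fin p) → P (Fin.toℕ r)) → ∀ t → P (t % p)
at-residue P p all t = subst P (Fin.toℕ-fromℕ< (m%n<n t p)) (all (Fin.fromℕ< (m%n<n t p)))

-- Configurations of linear forms

prime∤smaller : ∀ {P c} → Prime P → 0 < c → c < P → ¬ P ∣ c
prime∤smaller pp 0<c c<P P∣c = <⇒≱ c<P (∣⇒≤ {{>-nonZero 0<c}} P∣c)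

+φ-*-prime : ∀ {P c} → Prime P → ¬ P ∣ c → + φ (P * c) ≡ (+ P ℤ.- + 1) ℤ.* + φ c
+φ-*-prime {zero}  pp = contradiction pp ¬prime[0]
+φ-*-prime {suc Q} {c} pp P∤c = begin
  + φ (suc Q * c)                ≡⟨ cong +_ (φ-*-∤ pp P∤c) ⟩
  + (Q * φ c)                    ≡⟨ ℤ.pos-* Q (φ c) ⟩
  + Q ℤ.* + φ c                  ≡⟨ cong (ℤ._* + φ c) (pred-suc (+ Q)) ⟩
  (+ 1 ℤ.+ + Q ℤ.- + 1) ℤ.* + φ c ∎
  where
  open ≡-Reasoning
  pred-suc : ∀ x → x ≡ + 1 ℤ.+ x ℤ.- + 1
  pred-suc = ℤ-Solver.solve-∀

affine-link : ∀ a b m m′ β β′ g n → a ℤ.* m ≡ b ℤ.* m′ →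
  a ℤ.* (β ℤ.- + 1) ≡ b ℤ.* (β′ ℤ.- + 1) ℤ.+ g →
  (m ℤ.* n ℤ.+ β ℤ.- + 1) ℤ.* a ≡ (m′ ℤ.* n ℤ.+ β′ ℤ.- + 1) ℤ.* b ℤ.+ g
affine-link a b m m′ β β′ g n am≡bm′ a[β-1]≡b[β′-1]+g = begin
  (m ℤ.* n ℤ.+ β ℤ.- + 1) ℤ.* a          ≡⟨ expand a m β n ⟩
  (a ℤ.* m) ℤ.* n ℤ.+ a ℤ.* (β ℤ.- + 1) ≡⟨ cong₂ (λ x y → x ℤ.* n ℤ.+ y) am≡bm′ a[β-1]≡b[β′-1]+g ⟩
  (b ℤ.* m′) ℤ.* n ℤ.+ (b ℤ.* (β′ ℤ.- + 1) ℤ.+ g) ≡⟨ collapse b m′ β′ g n ⟩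
  (m′ ℤ.* n ℤ.+ β′ ℤ.- + 1) ℤ.* b ℤ.+ g ∎
  where
  open ≡-Reasoning
  expand : ∀ a m β n → (m ℤ.* n ℤ.+ β ℤ.- + 1) ℤ.* a ≡ (a ℤ.* m) ℤ.* n ℤ.+ a ℤ.* (β ℤ.- + 1)
  expand = ℤ-Solver.solve-∀
  collapse : ∀ b m′ β′ g n →
    (b ℤ.* m′) ℤ.* n ℤ.+ (b ℤ.* (β′ ℤ.- + 1) ℤ.+ g) ≡ (m′ ℤ.* n ℤ.+ β′ ℤ.- + 1) ℤ.* b ℤ.+ g
  collapse = ℤ-Solver.solve-∀

prime-pair-difference : ∀ {m m′ β β′ n P Q ca cb d} → Prime P → Prime Q →
  0 < ca → ca < P → 0 < cb → cb < Q → form m β (+ n) ≡ + P → form m′ β′ (+ n) ≡ + Q →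
  + φ ca ℤ.* + m ≡ + φ cb ℤ.* + m′ → + φ ca ℤ.* (β ℤ.- + 1) ≡ + φ cb ℤ.* (β′ ℤ.- + 1) ℤ.+ + d →
  φ (P * ca) ≡ φ (Q * cb) + d
prime-pair-difference {m} {m′} {β} {β′} {n} {P} {Q} {ca} {cb} {d} pP pQ 0<ca ca<P 0<cb cb<Q P≡ Q≡ slopes offsets =
  ℤ.+-injective (begin
    + φ (P * ca)                                        ≡⟨ +φ-*-prime pP (prime∤smaller pP 0<ca ca<P) ⟩
    (+ P ℤ.- + 1) ℤ.* + φ ca                            ≡⟨ cong (λ x → (x ℤ.- + 1) ℤ.* + φ ca) (sym P≡) ⟩
    (+ m ℤ.* + n ℤ.+ β ℤ.- + 1) ℤ.* + φ ca
      ≡⟨ affine-link (+ φ ca) (+ φ cb) (+ m) (+ m′) β β′ (+ d) (+ n) slopes offsets ⟩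
    (+ m′ ℤ.* + n ℤ.+ β′ ℤ.- + 1) ℤ.* + φ cb ℤ.+ + d    ≡⟨ cong (λ x → (x ℤ.- + 1) ℤ.* + φ cb ℤ.+ + d) Q≡ ⟩
    (+ Q ℤ.- + 1) ℤ.* + φ cb ℤ.+ + d
      ≡⟨ cong (ℤ._+ + d) (sym (+φ-*-prime pQ (prime∤smaller pQ 0<cb cb<Q))) ⟩
    + φ (Q * cb) ℤ.+ + d                                ≡⟨ sym (ℤ.pos-+ (φ (Q * cb)) d) ⟩
    + (φ (Q * cb) + d)                                  ∎)
  where open ≡-Reasoning

SolutionAbove : ℕ → ℕ → Set
SolutionAbove N d = ∃[ a ] ∃[ b ] (0 < a × 0 < b × N < a + b × φ a ≡ φ b + d)

-- Forms slope i · n + offset i + drift i · t, indexed by a parameter t.  When the primes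
-- P and Q of forms i and j appear together, a = P · cofactor i j and b = Q · cofactor j i
-- satisfy φ a = φ b + gap + gapDrift · t.
record Configuration (k : ℕ) : Set where
  field
    slope    : Fin k → ℕ
    offset   : Fin k → ℤ
    drift    : Fin k → ℤ
    gap      : ℕ
    gapDrift : ℕ
    cofactor : Fin k → Fin k → ℕ

  offsetAt : ℕ → Fin k → ℤ
  offsetAt t i = offset i ℤ.+ drift i ℤ.* + t

  gapAt : ℕ → ℕ
  gapAt t = gap + gapDrift * t

  Linked : Fin k → Fin k → Set
  Linked i j = 0 < a × 0 < b
             × + φ a ℤ.* + slope i ≡ + φ b ℤ.* + slope j
             × + φ a ℤ.* (offset i ℤ.- + 1) ≡ + φ b ℤ.* (offset j ℤ.- + 1) ℤ.+ + gap
             × + φ a ℤ.* drift i ≡ + φ b ℤ.* drift j ℤ.+ + gapDrift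
    where
    a = cofactor i j
    b = cofactor j i

  linked? : ∀ i j → Dec (Linked i j)
  linked? i j = 0 <? cofactor i j ×-dec 0 <? cofactor j i ×-dec _ ℤ.≟ _ ×-dec _ ℤ.≟ _ ×-dec _ ℤ.≟ _

  Valid : Set
  Valid = (∀ i → 0 < slope i) × (∀ i j → i ≢ j → Linked i j ⊎ Linked j i)

  valid? : Dec Valid
  valid? = Fin.all? (λ i → 0 <? slope i)
    ×-dec Fin.all? (λ i → Fin.all? (λ j → ¬? (i Fin.≟ j) →-dec (linked? i j ⊎-dec linked? j i)))

module _ {k} (F : Configuration k) where
  open Configuration F

  linked-offsets : ∀ {i j} → Linked i j → ∀ t →
    + φ (cofactor i j) ℤ.* (offsetAt t i ℤ.- + 1) ≡ + φ (cofactor j i) ℤ.* (offsetAt t j ℤ.- + 1) ℤ.+ + gapAt t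
  linked-offsets {i} {j} (_ , _ , _ , constant , drifting) t = begin
    a ℤ.* (offset i ℤ.+ drift i ℤ.* + t ℤ.- + 1)
      ≡⟨ split a (offset i) (drift i) (+ t) ⟩
    a ℤ.* (offset i ℤ.- + 1) ℤ.+ (a ℤ.* drift i) ℤ.* + t
      ≡⟨ cong₂ (λ x y → x ℤ.+ y ℤ.* + t) constant drifting ⟩
    (b ℤ.* (offset j ℤ.- + 1) ℤ.+ + gap) ℤ.+ (b ℤ.* drift j ℤ.+ + gapDrift) ℤ.* + t
      ≡⟨ merge b (offset j) (drift j) (+ gap) (+ gapDrift) (+ t) ⟩
    b ℤ.* (offset j ℤ.+ drift j ℤ.* + t ℤ.- + 1) ℤ.+ (+ gap ℤ.+ + gapDrift ℤ.* + t)
      ≡⟨ cong (λ x → b ℤ.* (offset j ℤ.+ drift j ℤ.* + t ℤ.- + 1) ℤ.+ x) (sym +gapAt) ⟩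
    b ℤ.* (offset j ℤ.+ drift j ℤ.* + t ℤ.- + 1) ℤ.+ + gapAt t ∎
    where
    open ≡-Reasoning
    a = + φ (cofactor i j)
    b = + φ (cofactor j i)
    +gapAt : + gapAt t ≡ + gap ℤ.+ + gapDrift ℤ.* + t
    +gapAt = trans (ℤ.pos-+ gap (gapDrift * t)) (cong (λ x → + gap ℤ.+ x) (ℤ.pos-* gapDrift t))
    split : ∀ a β γ t → a ℤ.* (β ℤ.+ γ ℤ.* t ℤ.- + 1) ≡ a ℤ.* (β ℤ.- + 1) ℤ.+ (a ℤ.* γ) ℤ.* t
    split = ℤ-Solver.solve-∀
    merge : ∀ b β γ g g′ t → (b ℤ.* (β ℤ.- + 1) ℤ.+ g) ℤ.+ (b ℤ.* γ ℤ.+ g′) ℤ.* t ≡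
                              b ℤ.* (β ℤ.+ γ ℤ.* t ℤ.- + 1) ℤ.+ (g ℤ.+ g′ ℤ.* t)
    merge = ℤ-Solver.solve-∀

  values-eventually-large : (∀ i → 0 < slope i) → ∀ t N → Eventually (λ n → ∀ i j {P} →
    form (slope i) (offsetAt t i) (+ n) ≡ + P → N + cofactor i j < P)
  values-eventually-large 0<slope t N = eventually-∀ k (λ i → eventually-∀ k (λ j → large i j))
    where
    large : ∀ i j → Eventually (λ n → ∀ {P} → form (slope i) (offsetAt t i) (+ n) ≡ + P → N + cofactor i j < P)
    large i j = N + cofactor i j + ℤ.∣ offsetAt t i ∣ , λ bound<n form≡P →
      +-cancelʳ-< ℤ.∣ offsetAt t i ∣ _ _ (<-≤-trans bound<n (form≡+⇒≤ (0<slope i) form≡P))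

  linked-solution : ∀ {i j N t n P Q} → Linked i j → Prime P → Prime Q →
    form (slope i) (offsetAt t i) (+ n) ≡ + P → form (slope j) (offsetAt t j) (+ n) ≡ + Q →
    N + cofactor i j < P → N + cofactor j i < Q → SolutionAbove N (gapAt t)
  linked-solution {i} {j} {N} {t} {P = P} {Q} L@(0<a , 0<b , slopes , _) pP pQ P≡ Q≡ large-P large-Q =
    P * a , Q * b , <-≤-trans 0<P P≤Pa , <-≤-trans 0<Q Q≤Qb ,
    <-≤-trans (≤-<-trans (m≤m+n N a) large-P) (≤-trans P≤Pa (m≤m+n (P * a) (Q * b))) ,
    prime-pair-difference pP pQ 0<a (≤-<-trans (m≤n+m a N) large-P) 0<b (≤-<-trans (m≤n+m b N) large-Q)
                          P≡ Q≡ slopes (linked-offsets L t)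
    where
    a = cofactor i j
    b = cofactor j i
    0<P : 0 < P
    0<P = <-trans z<s (prime⇒>1 pP)
    0<Q : 0 < Q
    0<Q = <-trans z<s (prime⇒>1 pQ)
    P≤Pa : P ≤ P * a
    P≤Pa = m≤m*n P a {{>-nonZero 0<a}}
    Q≤Qb : Q ≤ Q * b
    Q≤Qb = m≤m*n Q b {{>-nonZero 0<b}}

  valid⇒differences : Valid → ∀ t → Admissible k slope (offsetAt t) → DHL k 2 →
    InfinitelyManySolutions (gapAt t)
  valid⇒differences (0<slope , linked) t admissible dhl N with values-eventually-large 0<slope t N
  ... | n₀ , large with dhl slope (offsetAt t) 0<slope admissible n₀
  ... | n , n₀<n , σ , σ-injective , primes
    with primes fzero | primes (fsuc fzero) | linked (σ fzero) (σ (fsuc fzero)) (Fin.0≢1+n ∘ σ-injective)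
  ... | P , P≡ , pP | Q , Q≡ , pQ | inj₁ L = linked-solution L pP pQ P≡ Q≡ (large n₀<n _ _ P≡) (large n₀<n _ _ Q≡)
  ... | P , P≡ , pP | Q , Q≡ , pQ | inj₂ L = linked-solution L pQ pP Q≡ P≡ (large n₀<n _ _ Q≡) (large n₀<n _ _ P≡)

  -- Changing the parameter by a multiple of p does not change the forms modulo p.
  admissibleAt-shift : ∀ {p} r q → AdmissibleAt p k slope (offsetAt r) → AdmissibleAt p k slope (offsetAt (r + q * p))
  admissibleAt-shift {p} r q (x , p∤Π[r]) = x , λ p∣Π[t] →
    p∤Π[r] (∣⇒∣ᵤ (Signed.∣m+n∣m⇒∣n (subst (+ p ∣ℤ_) (difference Π[t] Π[r]) (∣ᵤ⇒∣ {+ p} {Π[t]} p∣Π[t]))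
                                   (prodFin-congruent k _ _ factor-congruent)))
    where
    value : ℕ → Fin k → ℤ
    value t i = form (slope i) (offsetAt t i) x
    Π[t] = prodFin k (value (r + q * p))
    Π[r] = prodFin k (value r)
    difference : ∀ a b → a ≡ (a ℤ.- b) ℤ.+ b
    difference = ℤ-Solver.solve-∀
    factor-congruent : ∀ i → + p ∣ℤ value (r + q * p) i ℤ.- value r i
    factor-congruent i = Signed.divides (drift i ℤ.* + q) (begin
      value (r + q * p) i ℤ.- value r i ≡⟨ cong (λ s → form (slope i) (offset i ℤ.+ drift i ℤ.* s) x ℤ.- value r i)
                                                (trans (ℤ.pos-+ r (q * p)) (cong (λ s → + r ℤ.+ s) (ℤ.pos-* q p))) ⟩
      form (slope i) (offset i ℤ.+ drift i ℤ.* (+ r ℤ.+ + q ℤ.* + p)) x ℤ.- value r i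
                                          ≡⟨ cancel (+ slope i) x (offset i) (drift i) (+ r) (+ q) (+ p) ⟩
      drift i ℤ.* + q ℤ.* + p ∎)
      where
      open ≡-Reasoning
      cancel : ∀ m x β γ r q p →
        m ℤ.* x ℤ.+ (β ℤ.+ γ ℤ.* (r ℤ.+ q ℤ.* p)) ℤ.- (m ℤ.* x ℤ.+ (β ℤ.+ γ ℤ.* r)) ≡ γ ℤ.* q ℤ.* p
      cancel = ℤ-Solver.solve-∀

  AdmissibleAt2∧3 : ℕ → Set
  AdmissibleAt2∧3 r = AdmissibleWithin 2 k slope (offsetAt r) × AdmissibleWithin 3 k slope (offsetAt r)

  admissibleAt2∧3? : ∀ r → Dec (AdmissibleAt2∧3 r)
  admissibleAt2∧3? r = admissibleWithin? 2 k slope (offsetAt r) ×-dec admissibleWithin? 3 k slope (offsetAt r)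

  admissible-mod-6 : k ≤ 4 → (∀ i → 0 < slope i) → (∀ i → slope i ≤ 4) → ∀ r q → AdmissibleAt2∧3 r →
    Admissible k slope (offsetAt (r + q * 6))
  admissible-mod-6 k≤4 0<slope slope≤4 r q (at2 , at3) = admissible-from-2-and-3 k≤4 0<slope slope≤4
    (subst (λ t → AdmissibleAt 2 k slope (offsetAt t)) (cong (λ m → r + m) (*-assoc q 3 2))
           (admissibleAt-shift r (q * 3) (within⇒at {k = k} {slope} {offsetAt r} at2)))
    (subst (λ t → AdmissibleAt 3 k slope (offsetAt t)) (cong (λ m → r + m) (*-assoc q 2 3))
           (admissibleAt-shift r (q * 2) (within⇒at {k = k} {slope} {offsetAt r} at3)))

  differences-mod-6 : Valid → k ≤ 4 → (∀ i → slope i ≤ 4) → ∀ t → AdmissibleAt2∧3 (t % 6) → DHL k 2 →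
    InfinitelyManySolutions (gapAt t)
  differences-mod-6 valid k≤4 slope≤4 t good = valid⇒differences valid t
    (subst (λ t → Admissible k slope (offsetAt t)) (sym (m≡m%n+[m/n]*n t 6))
           (admissible-mod-6 k≤4 (proj₁ valid) slope≤4 (t % 6) (t / 6) good))

  differences-small-primes : Valid → ∀ M t → k ≤ M → (∀ i → slope i ≤ M) →
    SmallPrimesAdmissible M k slope (offsetAt t) → DHL k 2 → InfinitelyManySolutions (gapAt t)
  differences-small-primes valid M t k≤M slope≤M small = valid⇒differences valid t
    (admissible-from-small-primes M k≤M (proj₁ valid) slope≤M (smallPrimesAdmissible⇒ {M} {k} {slope} {offsetAt t} small))

-- Row i lists the cofactors of form i against each j.
table : ∀ {k} → Vec (Vec ℕ k) k → Fin k → Fin k → ℕ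
table rows i j = lookup (lookup rows i) j

configuration[2t] : Configuration 3
configuration[2t] = record
  { slope    = lookup (1 ∷ 2 ∷ 4 ∷ [])
  ; offset   = λ _ → + 1
  ; drift    = lookup (+ 0 ∷ + 2 ∷ + 2 ∷ [])
  ; gap      = 0
  ; gapDrift = 2
  ; cofactor = table ( (1 ∷ 3 ∷ 5 ∷ [])
                     ∷ (1 ∷ 1 ∷ 3 ∷ [])
                     ∷ (1 ∷ 1 ∷ 1 ∷ []) ∷ [])
  }

-- With the sign +, the form 3n + 1 + 2t is a multiple of 3 whenever t ≡ 1 (mod 3).
configuration[4t] : Sign → Configuration 4
configuration[4t] s = record
  { slope    = lookup (1 ∷ 2 ∷ 3 ∷ 4 ∷ [])
  ; offset   = λ _ → + 1
  ; drift    = λ i → s ◃ lookup (0 ∷ 2 ∷ 2 ∷ 2 ∷ []) i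
  ; gap      = 0
  ; gapDrift = 4
  ; cofactor = table ( (1 ∷ 5 ∷ 7 ∷ 15 ∷ [])
                     ∷ (3 ∷ 1 ∷ 7 ∷  5 ∷ [])
                     ∷ (3 ∷ 5 ∷ 1 ∷ 15 ∷ [])
                     ∷ (3 ∷ 3 ∷ 7 ∷  1 ∷ []) ∷ [])
  }

configuration[4] : Configuration 5
configuration[4] = record
  { slope    = lookup (1 ∷ 6 ∷ 8 ∷ 9 ∷ 12 ∷ [])
  ; offset   = λ i → ℤ.- + lookup (2 ∷ 19 ∷ 25 ∷ 28 ∷ 37 ∷ []) i
  ; drift    = λ _ → + 0
  ; gap      = 4
  ; gapDrift = 0
  ; cofactor = table ( (1 ∷ 13 ∷ 17 ∷ 19 ∷ 35 ∷ [])
                     ∷ (3 ∷  1 ∷ 15 ∷  7 ∷  5 ∷ [])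
                     ∷ (3 ∷  7 ∷  1 ∷ 19 ∷  7 ∷ [])
                     ∷ (3 ∷  5 ∷ 17 ∷  1 ∷ 15 ∷ [])
                     ∷ (3 ∷  3 ∷  5 ∷  7 ∷  1 ∷ []) ∷ [])
  }

configuration[8] : Configuration 6
configuration[8] = record
  { slope    = lookup (1 ∷ 6 ∷ 8 ∷ 9 ∷ 10 ∷ 12 ∷ [])
  ; offset   = λ i → ℤ.- + lookup (3 ∷ 25 ∷ 33 ∷ 37 ∷ 41 ∷ 49 ∷ []) i
  ; drift    = λ _ → + 0
  ; gap      = 8
  ; gapDrift = 0
  ; cofactor = table ( (1 ∷ 35 ∷ 51 ∷ 37 ∷ 41 ∷ 65 ∷ [])
                     ∷ (5 ∷  1 ∷ 17 ∷ 13 ∷ 11 ∷ 15 ∷ [])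
                     ∷ (5 ∷ 13 ∷  1 ∷ 37 ∷ 25 ∷ 13 ∷ [])
                     ∷ (5 ∷ 15 ∷ 51 ∷  1 ∷ 41 ∷ 17 ∷ [])
                     ∷ (5 ∷  7 ∷ 17 ∷ 37 ∷  1 ∷ 35 ∷ [])
                     ∷ (5 ∷  5 ∷ 15 ∷ 13 ∷ 25 ∷  1 ∷ []) ∷ [])
  }

even-differences : DHL 3 2 → ∀ h → InfinitelyManySolutions (2 * h)
even-differences dhl h = differences-mod-6 F (from-yes (valid? F)) (from-yes (3 ≤? 4))
  (from-yes (Fin.all? λ i → slope F i ≤? 4))
  h (at-residue (AdmissibleAt2∧3 F) 6 (from-yes (Fin.all? {n = 6} λ r → admissibleAt2∧3? F (Fin.toℕ r))) h) dhl
  where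
  F = configuration[2t]
  open Configuration

differences-4* : DHL 4 2 → ∀ t → InfinitelyManySolutions (4 * t)
differences-4* dhl t = case at-residue Good 6 residues t of λ where
    (inj₁ good) → differences-with Sign.+ good
    (inj₂ good) → differences-with Sign.- good
  where
  F = configuration[4t]
  open Configuration
  Good : ℕ → Set
  Good r = AdmissibleAt2∧3 (F Sign.+) r ⊎ AdmissibleAt2∧3 (F Sign.-) r
  residues : ∀ (r : Fin 6) → Good (Fin.toℕ r)
  residues = from-yes (Fin.all? {n = 6} λ r →
    admissibleAt2∧3? (F Sign.+) (Fin.toℕ r) ⊎-dec admissibleAt2∧3? (F Sign.-) (Fin.toℕ r))
  valid : ∀ s → Valid (F s)
  valid Sign.+ = from-yes (valid? (F Sign.+))
  valid Sign.- = from-yes (valid? (F Sign.-))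
  differences-with : ∀ s → AdmissibleAt2∧3 (F s) (t % 6) → InfinitelyManySolutions (4 * t)
  differences-with s good = differences-mod-6 (F s) (valid s) (from-yes (4 ≤? 4))
    (from-yes (Fin.all? λ i → slope (F s) i ≤? 4)) t good dhl

difference-4 : DHL 5 2 → InfinitelyManySolutions 4
difference-4 = differences-small-primes F (from-yes (valid? F)) 12 0
  (from-yes (5 ≤? 12)) (from-yes (Fin.all? λ i → slope F i ≤? 12))
  (from-yes (smallPrimesAdmissible? 12 5 (slope F) (offsetAt F 0)))
  where
  F = configuration[4]
  open Configuration

difference-8 : DHL 6 2 → InfinitelyManySolutions 8
difference-8 = differences-small-primes F (from-yes (valid? F)) 12 0
  (from-yes (6 ≤? 12)) (from-yes (Fin.all? λ i → slope F i ≤? 12))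
  (from-yes (smallPrimesAdmissible? 12 6 (slope F) (offsetAt F 0)))
  where
  F = configuration[8]
  open Configuration

theorem3 : (DHL 3 2 → ∀ (d : ℕ) → InD d ⇔ (0 < d × 2 ∣ d))
    × (DHL 4 2 → ∀ (t : ℕ) → 0 < t → InD (4 * t))
    × (DHL 5 2 → ∃[ d ] (d ≤ 6 × InD d))
    × (DHL 6 2 → InD 8)
theorem3 =
  (λ dhl d → mk⇔ (λ (0<d , sols) → 0<d , InfinitelyManySolutions⇒even sols)
                 (λ (0<d , divides h d≡h*2) →
                    0<d , subst InfinitelyManySolutions (sym (trans d≡h*2 (*-comm h 2))) (even-differences dhl h))) ,
  (λ { dhl (suc t) _ → z<s , differences-4* dhl (suc t) }) ,
  (λ dhl → 4 , from-yes (4 ≤? 6) , z<s , difference-4 dhl) ,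
  (λ dhl → z<s , difference-8 dhl)
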